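{- Fix $\mathbf r\in\mathbb N^I$, $\mathbf c\in\mathbb N^J$ with $\sum_i r_i=\sum_j c_j$. Let $\mathcal I=\{\mathbf g_1,\dots,\mathbf g_N\}$ be an improper multiset whose improper graph is $\mathbf g_k$ with $g_k(ij)=-1$. Then, by a swap operation among two graphs of $\mathcal I$, $\mathcal I$ can be transformed into a proper multiset.
   Context: A proper graph is a nonnegative integer $I\times J$ matrix with row sums $\mathbf r$ and column sums $\mathbf c$. An improper graph is an integer $I\times J$ matrix with row sums $\mathbf r$ and column sums $\mathbf c$ having exactly one entry $(i^*,j^*)$ (the improper edge) with value $-1$ and all other entries nonnegative. A multiset $\{\mathbf g_1,\dots,\mathbf g_N\}$ is proper if every element is a proper graph, and improper if exactly one element is an improper graph, the others are proper graphs, and $\sum_{l=1}^N g_l(ij)\ge 0$ for all $i,j$. A swap operation among $\mathbf g_{k_1},\mathbf g_{k_2}$ replaces them by $\mathbf g_{k_1}+Z$ and $\mathbf g_{k_2}-Z$, where $Z$ is a sum of finitely many matrices each having $+1$ in an entry $(i_2,j)$, $-1$ in an entry $(i_1,j)$ of the same column $j$, and $0$ elsewhere; the other elements are unchanged. -}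

module Defs where

open import Data.Nat using (ℕ; zero; suc)
import Data.Nat as ℕ
open import Data.Integer using (ℤ; +_; -[1+_]; _+_; _-_; _≤_; 0ℤ; 1ℤ)
open import Data.Fin using (Fin; zero; suc; _≟_)
open import Data.List using (List; foldr)
open import Data.Product using (_×_; _,_; ∃-syntax)
open import Data.Bool using (Bool; true; false; if_then_else_; _∧_)
open import Relation.Nullary using (¬_; does)
open import Relation.Binary.PropositionalEquality using (_≡_)

Σℕ : (n : ℕ) → (Fin n → ℕ) → ℕ
Σℕ zero    f = 0
Σℕ (suc n) f = f zero ℕ.+ Σℕ n (λ i → f (suc i))

Σℤ : (n : ℕ) → (Fin n → ℤ) → ℤ
Σℤ zero    f = 0ℤ
Σℤ (suc n) f = f zero + Σℤ n (λ i → f (suc i))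

Mat : ℕ → ℕ → Set
Mat I J = Fin I → Fin J → ℤ

_⊕_ : ∀ {I J} → Mat I J → Mat I J → Mat I J
(A ⊕ B) i j = A i j + B i j

_⊖_ : ∀ {I J} → Mat I J → Mat I J → Mat I J
(A ⊖ B) i j = A i j - B i j

HasMargins : ∀ {I J} → (Fin I → ℕ) → (Fin J → ℕ) → Mat I J → Set
HasMargins {I} {J} r c g =
  (∀ i → Σℤ J (λ j → g i j) ≡ + r i) × (∀ j → Σℤ I (λ i → g i j) ≡ + c j)

Proper : ∀ {I J} → (Fin I → ℕ) → (Fin J → ℕ) → Mat I J → Set
Proper r c g = HasMargins r c g × (∀ i j → 0ℤ ≤ g i j)

Improper : ∀ {I J} → (Fin I → ℕ) → (Fin J → ℕ) → Mat I J → Set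
Improper {I} {J} r c g =
  HasMargins r c g ×
  ∃[ i* ] ∃[ j* ] (g i* j* ≡ -[1+ 0 ] ×
                   (∀ i j → ¬ (i ≡ i* × j ≡ j*) → 0ℤ ≤ g i j))

-- a family g₁..g_N (multiset) is proper
ProperFamily : ∀ {I J N} → (Fin I → ℕ) → (Fin J → ℕ) → (Fin N → Mat I J) → Set
ProperFamily r c G = ∀ l → Proper r c (G l)

ImproperFamilyAt : ∀ {I J N} → (Fin I → ℕ) → (Fin J → ℕ) →
                   (Fin N → Mat I J) → Fin N → Set
ImproperFamilyAt {I} {J} {N} r c G k =
  Improper r c (G k) ×
  (∀ l → ¬ (l ≡ k) → Proper r c (G l)) ×
  (∀ i j → 0ℤ ≤ Σℤ N (λ l → G l i j))

δ : ∀ {n} → Fin n → Fin n → Bool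
δ a b = does (a ≟ b)

ind : Bool → ℤ
ind true  = 1ℤ
ind false = 0ℤ

Move : ℕ → ℕ → Set
Move I J = Fin I × Fin I × Fin J

moveMat : ∀ {I J} → Move I J → Mat I J
moveMat (i₁ , i₂ , j) a b = ind (δ a i₂ ∧ δ b j) - ind (δ a i₁ ∧ δ b j)

zeroMat : ∀ {I J} → Mat I J
zeroMat _ _ = 0ℤ

sumMoves : ∀ {I J} → List (Move I J) → Mat I J
sumMoves ms = foldr (λ m Z → moveMat m ⊕ Z) zeroMat ms

swap : ∀ {I J N} → (Fin N → Mat I J) → Fin N → Fin N → Mat I J → Fin N → Mat I J
swap G k₁ k₂ Z l =
  if δ l k₁ then G l ⊕ Z
  else if δ l k₂ then G l ⊖ Z
  else G l

-- Let g_k carry the improper entry g_k(i*,j*) = -1.  Since the column sum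
-- Σ_l g_l(i*,j*) is nonnegative, some other graph g_l is positive at
-- (i*,j*).  The difference D = g_l - g_k has zero row and column sums and
-- D(i*,j*) > 0.  The heart of the proof is the cycle lemma: such a D
-- contains a "conformal cycle" through (i*,j*), i.e. a sum Z of column moves
-- with zero row sums, Z(i*,j*) = 1, and every entry of Z lying between 0 and
-- the corresponding entry of D.  Then g_k + Z and g_l - Z stay between g_k
-- and g_l entrywise (hence nonnegative), keep the margins, and the -1 is
-- cancelled, so the swap with Z among g_k, g_l gives a proper multiset.
--
-- The cycle is built by walking along D: from the positive entry (a,b) go
-- to a negative entry (a,b') of row a, then to a positive entry (a',b') of
-- column b'.  If (a',b) is negative the "square" a,a',b,b' closes the cycle;
-- otherwise subtract the square from D, which strictly decreases the total
-- negative mass, and continue from the positive entry (a',b).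
module Submission where

open import Defs
open import Data.Nat using (ℕ)
open import Data.Fin using (Fin)
open import Data.List using (List)
open import Data.Product using (_×_; ∃-syntax)
open import Relation.Nullary using (¬_)
open import Relation.Binary.PropositionalEquality using (_≡_)

open import Data.Nat using (zero; suc; z≤n; s≤s)
import Data.Nat as ℕ
import Data.Nat.Properties as ℕP
open import Data.Nat.Induction using (<-wellFounded)
open import Induction.WellFounded using (Acc; acc)
open import Data.Integer using (ℤ; +_; -[1+_]; _+_; _-_; _≤_; _<_; 0ℤ; 1ℤ; -1ℤ; +≤+; -≤+; -≤-; +<+; -<+)
import Data.Integer.Properties as ℤP
open import Data.Integer.Tactic.RingSolver using (solve-∀)
open import Data.Fin using (zero; suc; _≟_)
import Data.Fin.Properties as FinP
open import Data.List using ([]; _∷_; _++_)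
open import Data.Product using (_,_; proj₁; proj₂)
open import Data.Sum using (inj₁; inj₂; _⊎_)
open import Data.Bool using (true; false; _∧_)
open import Data.Bool.Properties using (∧-identityʳ; ∧-zeroʳ)
open import Data.Empty using (⊥-elim)
open import Relation.Nullary using (Dec; yes; no; _×-dec_)
open import Relation.Nullary.Decidable using (dec-true; dec-false)
open import Relation.Binary.PropositionalEquality using (refl; sym; trans; cong; cong₂; subst)

Σℤ-cong : ∀ n {f g : Fin n → ℤ} → (∀ i → f i ≡ g i) → Σℤ n f ≡ Σℤ n g
Σℤ-cong zero    f≗g = refl
Σℤ-cong (suc n) f≗g = cong₂ _+_ (f≗g zero) (Σℤ-cong n (λ i → f≗g (suc i)))

Σℤ-zero : ∀ n → Σℤ n (λ _ → 0ℤ) ≡ 0ℤ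
Σℤ-zero zero    = refl
Σℤ-zero (suc n) = trans (ℤP.+-identityˡ _) (Σℤ-zero n)

Σℤ-add : ∀ n (f g : Fin n → ℤ) → Σℤ n (λ i → f i + g i) ≡ Σℤ n f + Σℤ n g
Σℤ-add zero    f g = refl
Σℤ-add (suc n) f g =
  trans (cong (_+_ (f zero + g zero)) (Σℤ-add n (λ i → f (suc i)) (λ i → g (suc i))))
        (interchange (f zero) (g zero) _ _)
  where
  interchange : ∀ a b c d → (a + b) + (c + d) ≡ (a + c) + (b + d)
  interchange = solve-∀

Σℤ-sub : ∀ n (f g : Fin n → ℤ) → Σℤ n (λ i → f i - g i) ≡ Σℤ n f - Σℤ n g
Σℤ-sub zero    f g = refl
Σℤ-sub (suc n) f g =
  trans (cong (_+_ (f zero - g zero)) (Σℤ-sub n (λ i → f (suc i)) (λ i → g (suc i))))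
        (interchange (f zero) (g zero) _ _)
  where
  interchange : ∀ a b c d → (a - b) + (c - d) ≡ (a + c) - (b + d)
  interchange = solve-∀

Σℤ-indicator : ∀ n (x : Fin n) → Σℤ n (λ i → ind (δ i x)) ≡ 1ℤ
Σℤ-indicator (suc n) zero    = cong (_+_ 1ℤ) (Σℤ-zero n)
Σℤ-indicator (suc n) (suc x) = trans (ℤP.+-identityˡ _) (Σℤ-indicator n x)

Σℤ-indicator-∧ : ∀ n (x : Fin n) c → Σℤ n (λ i → ind (δ i x ∧ c)) ≡ ind c
Σℤ-indicator-∧ n x true  =
  trans (Σℤ-cong n (λ i → cong ind (∧-identityʳ (δ i x)))) (Σℤ-indicator n x)
Σℤ-indicator-∧ n x false =
  trans (Σℤ-cong n (λ i → cong ind (∧-zeroʳ (δ i x)))) (Σℤ-zero n)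

∧-Σℤ-indicator : ∀ n (y : Fin n) c → Σℤ n (λ j → ind (c ∧ δ j y)) ≡ ind c
∧-Σℤ-indicator n y true  = Σℤ-indicator n y
∧-Σℤ-indicator n y false = Σℤ-zero n

ZeroRowSums : ∀ {I J} → Mat I J → Set
ZeroRowSums {I} {J} Z = ∀ i → Σℤ J (λ j → Z i j) ≡ 0ℤ

ZeroColSums : ∀ {I J} → Mat I J → Set
ZeroColSums {I} {J} Z = ∀ j → Σℤ I (λ i → Z i j) ≡ 0ℤ

-- A move (i₁, i₂, j) shifts one unit inside column j, so column sums vanish ...
move-columns : ∀ {I J} (m : Move I J) → ZeroColSums (moveMat m)
move-columns {I} (i₁ , i₂ , j₀) j =
  trans (Σℤ-sub I (λ i → ind (δ i i₂ ∧ δ j j₀)) (λ i → ind (δ i i₁ ∧ δ j j₀)))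
        (trans (cong₂ _-_ (Σℤ-indicator-∧ I i₂ (δ j j₀)) (Σℤ-indicator-∧ I i₁ (δ j j₀)))
               (ℤP.+-inverseʳ (ind (δ j j₀))))

move-row : ∀ {I J} (i₁ i₂ : Fin I) (j₀ : Fin J) i →
           Σℤ J (λ j → moveMat (i₁ , i₂ , j₀) i j) ≡ ind (δ i i₂) - ind (δ i i₁)
move-row {I} {J} i₁ i₂ j₀ i =
  trans (Σℤ-sub J (λ j → ind (δ i i₂ ∧ δ j j₀)) (λ j → ind (δ i i₁ ∧ δ j j₀)))
        (cong₂ _-_ (∧-Σℤ-indicator J j₀ (δ i i₂)) (∧-Σℤ-indicator J j₀ (δ i i₁)))

moves-columns : ∀ {I J} (ms : List (Move I J)) → ZeroColSums (sumMoves ms)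
moves-columns {I} []       j = Σℤ-zero I
moves-columns {I} (m ∷ ms) j =
  trans (Σℤ-add I (λ i → moveMat m i j) (λ i → sumMoves ms i j))
        (cong₂ _+_ (move-columns m j) (moves-columns ms j))

sumMoves-++ : ∀ {I J} (xs ys : List (Move I J)) i j →
              sumMoves (xs ++ ys) i j ≡ sumMoves xs i j + sumMoves ys i j
sumMoves-++ []       ys i j = sym (ℤP.+-identityˡ _)
sumMoves-++ (x ∷ xs) ys i j =
  trans (cong (_+_ (moveMat x i j)) (sumMoves-++ xs ys i j)) (sym (ℤP.+-assoc (moveMat x i j) _ _))

margins-⊕ : ∀ {I J} {r : Fin I → ℕ} {c : Fin J → ℕ} {A Z : Mat I J} →
            HasMargins r c A → ZeroRowSums Z → ZeroColSums Z → HasMargins r c (A ⊕ Z)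
margins-⊕ {I} {J} {A = A} {Z} (rowsA , colsA) rowsZ colsZ =
  (λ i → trans (Σℤ-add J (A i) (Z i)) (trans (cong₂ _+_ (rowsA i) (rowsZ i)) (ℤP.+-identityʳ _))) ,
  (λ j → trans (Σℤ-add I (λ i → A i j) (λ i → Z i j))
               (trans (cong₂ _+_ (colsA j) (colsZ j)) (ℤP.+-identityʳ _)))

margins-⊖ : ∀ {I J} {r : Fin I → ℕ} {c : Fin J → ℕ} {A Z : Mat I J} →
            HasMargins r c A → ZeroRowSums Z → ZeroColSums Z → HasMargins r c (A ⊖ Z)
margins-⊖ {I} {J} {A = A} {Z} (rowsA , colsA) rowsZ colsZ =
  (λ i → trans (Σℤ-sub J (A i) (Z i)) (trans (cong₂ _-_ (rowsA i) (rowsZ i)) (ℤP.+-identityʳ _))) ,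
  (λ j → trans (Σℤ-sub I (λ i → A i j) (λ i → Z i j))
               (trans (cong₂ _-_ (colsA j) (colsZ j)) (ℤP.+-identityʳ _)))

margins-difference : ∀ {I J} {r : Fin I → ℕ} {c : Fin J → ℕ} {A B : Mat I J} →
                     HasMargins r c A → HasMargins r c B →
                     ZeroRowSums (A ⊖ B) × ZeroColSums (A ⊖ B)
margins-difference {I} {J} {r} {c} {A} {B} (rowsA , colsA) (rowsB , colsB) =
  (λ i → trans (Σℤ-sub J (A i) (B i))
               (trans (cong₂ _-_ (rowsA i) (rowsB i)) (ℤP.+-inverseʳ (+ r i)))) ,
  (λ j → trans (Σℤ-sub I (λ i → A i j) (λ i → B i j))
               (trans (cong₂ _-_ (colsA j) (colsB j)) (ℤP.+-inverseʳ (+ c j))))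

≤-+ˡ : ∀ {x} y → 0ℤ ≤ y → x ≤ y + x
≤-+ˡ {x} y 0≤y = subst (_≤ y + x) (ℤP.+-identityˡ x) (ℤP.+-monoˡ-≤ x 0≤y)

+ˡ-≤ : ∀ {x} y → y ≤ 0ℤ → y + x ≤ x
+ˡ-≤ {x} y y≤0 = subst (y + x ≤_) (ℤP.+-identityˡ x) (ℤP.+-monoˡ-≤ x y≤0)

Σℤ-nonneg : ∀ n (f : Fin n → ℤ) → (∀ y → 0ℤ ≤ f y) → 0ℤ ≤ Σℤ n f
Σℤ-nonneg zero    f 0≤f = ℤP.≤-refl
Σℤ-nonneg (suc n) f 0≤f = ℤP.+-mono-≤ (0≤f zero) (Σℤ-nonneg n _ (λ y → 0≤f (suc y)))

Σℤ-nonpos : ∀ n (f : Fin n → ℤ) → (∀ y → f y ≤ 0ℤ) → Σℤ n f ≤ 0ℤ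
Σℤ-nonpos zero    f f≤0 = ℤP.≤-refl
Σℤ-nonpos (suc n) f f≤0 = ℤP.+-mono-≤ (f≤0 zero) (Σℤ-nonpos n _ (λ y → f≤0 (suc y)))

term≤Σℤ : ∀ n (f : Fin n → ℤ) → (∀ y → 0ℤ ≤ f y) → ∀ x → f x ≤ Σℤ n f
term≤Σℤ (suc n) f 0≤f zero    =
  subst (_≤ Σℤ (suc n) f) (ℤP.+-identityʳ (f zero))
        (ℤP.+-monoʳ-≤ (f zero) (Σℤ-nonneg n _ (λ y → 0≤f (suc y))))
term≤Σℤ (suc n) f 0≤f (suc x) =
  ℤP.≤-trans (term≤Σℤ n _ (λ y → 0≤f (suc y)) x) (≤-+ˡ (f zero) (0≤f zero))

Σℤ≤term : ∀ n (f : Fin n → ℤ) → (∀ y → f y ≤ 0ℤ) → ∀ x → Σℤ n f ≤ f x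
Σℤ≤term (suc n) f f≤0 zero    =
  subst (Σℤ (suc n) f ≤_) (ℤP.+-identityʳ (f zero))
        (ℤP.+-monoʳ-≤ (f zero) (Σℤ-nonpos n _ (λ y → f≤0 (suc y))))
Σℤ≤term (suc n) f f≤0 (suc x) =
  ℤP.≤-trans (+ˡ-≤ (f zero) (f≤0 zero)) (Σℤ≤term n _ (λ y → f≤0 (suc y)) x)

negative-entry : ∀ n (f : Fin n → ℤ) → Σℤ n f ≡ 0ℤ → ∀ x → 0ℤ < f x → ∃[ y ] f y < 0ℤ
negative-entry n f Σf≡0 x 0<fx with FinP.any? (λ y → f y ℤP.<? 0ℤ)
... | yes found = found
... | no none    = ⊥-elim (ℤP.<-irrefl refl (ℤP.<-≤-trans 0<fx
                     (subst (f x ≤_) Σf≡0 (term≤Σℤ n f (λ y → ℤP.≮⇒≥ (λ fy<0 → none (y , fy<0))) x))))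

positive-entry : ∀ n (f : Fin n → ℤ) → 0ℤ ≤ Σℤ n f → ∀ x → f x < 0ℤ → ∃[ y ] 0ℤ < f y
positive-entry n f 0≤Σf x fx<0 with FinP.any? (λ y → 0ℤ ℤP.<? f y)
... | yes found = found
... | no none    = ⊥-elim (ℤP.<-irrefl refl (ℤP.≤-<-trans 0≤Σf
                     (ℤP.≤-<-trans (Σℤ≤term n f (λ y → ℤP.≮⇒≥ (λ 0<fy → none (y , 0<fy))) x) fx<0)))

0<+1 : ∀ {x} → 0ℤ ≤ x → 0ℤ < x - -1ℤ
0<+1 0≤x = ℤP.suc[i]≤j⇒i<j (ℤP.+-monoˡ-≤ 1ℤ 0≤x)

sign-separates : ∀ {n} (f : Fin n → ℤ) {x y} → f x < 0ℤ → 0ℤ < f y → ¬ x ≡ y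
sign-separates f fx<0 0<fy refl = ℤP.<-asym fx<0 0<fy

-- z is conformal to d when it lies between 0 and d (inclusive); a conformal
-- cycle moves each entry of one graph towards the other without overshooting.
Conformal : ℤ → ℤ → Set
Conformal d z = (0ℤ ≤ z × z ≤ d) ⊎ (d ≤ z × z ≤ 0ℤ)

conformal-zero : ∀ d → Conformal d 0ℤ
conformal-zero d with ℤP.≤-total 0ℤ d
... | inj₁ 0≤d = inj₁ (ℤP.≤-refl , 0≤d)
... | inj₂ d≤0 = inj₂ (d≤0 , ℤP.≤-refl)

conformal-one : ∀ {d} → 0ℤ < d → Conformal d 1ℤ
conformal-one 0<d = inj₁ (+≤+ z≤n , ℤP.i<j⇒suc[i]≤j 0<d)

conformal-minus-one : ∀ {d} → d < 0ℤ → Conformal d -1ℤ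
conformal-minus-one d<0 = inj₂ (ℤP.i<j⇒i≤pred[j] d<0 , -≤+)

conformal-nonneg : ∀ {d z} → 0ℤ ≤ d → Conformal d z → 0ℤ ≤ z × z ≤ d
conformal-nonneg 0≤d (inj₁ between)    = between
conformal-nonneg 0≤d (inj₂ (d≤z , z≤0)) = ℤP.≤-trans 0≤d d≤z , ℤP.≤-trans z≤0 0≤d

conformal-nonpos : ∀ {d z} → d ≤ 0ℤ → Conformal d z → d ≤ z × z ≤ 0ℤ
conformal-nonpos d≤0 (inj₁ (0≤z , z≤d)) = ℤP.≤-trans d≤0 0≤z , ℤP.≤-trans z≤d d≤0
conformal-nonpos d≤0 (inj₂ between)    = between

s+[d-s]≡d : ∀ s d → s + (d - s) ≡ d
s+[d-s]≡d = solve-∀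

conformal-+ : ∀ {d s z} → Conformal d s → Conformal (d - s) z → Conformal d (s + z)
conformal-+ {d} {s} {z} (inj₁ (0≤s , s≤d)) rest
  with conformal-nonneg (ℤP.i≤j⇒0≤j-i s≤d) rest
... | 0≤z , z≤d-s =
  inj₁ (ℤP.+-mono-≤ 0≤s 0≤z , subst (s + z ≤_) (s+[d-s]≡d s d) (ℤP.+-monoʳ-≤ s z≤d-s))
conformal-+ {d} {s} {z} (inj₂ (d≤s , s≤0)) rest
  with conformal-nonpos (ℤP.i≤j⇒i-j≤0 d≤s) rest
... | d-s≤z , z≤0 =
  inj₂ (subst (_≤ s + z) (s+[d-s]≡d s d) (ℤP.+-monoʳ-≤ s d-s≤z) , ℤP.+-mono-≤ s≤0 z≤0)

conformal-interpolate : ∀ {gk gl z} → Conformal (gl - gk) z → 0ℤ ≤ gk → 0ℤ ≤ gl →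
                        0ℤ ≤ gk + z × 0ℤ ≤ gl - z
conformal-interpolate {gk} {gl} {z} (inj₁ (0≤z , z≤gl-gk)) 0≤gk 0≤gl =
  ℤP.+-mono-≤ 0≤gk 0≤z ,
  subst (0ℤ ≤_) (rearrange gk gl z) (ℤP.+-mono-≤ (ℤP.i≤j⇒0≤j-i z≤gl-gk) 0≤gk)
  where
  rearrange : ∀ gk gl z → (gl - gk - z) + gk ≡ gl - z
  rearrange = solve-∀
conformal-interpolate {gk} {gl} {z} (inj₂ (gl-gk≤z , z≤0)) 0≤gk 0≤gl =
  subst (0ℤ ≤_) (rearrange₁ gk gl z) (ℤP.+-mono-≤ (ℤP.i≤j⇒0≤j-i gl-gk≤z) 0≤gl) ,
  subst (0ℤ ≤_) (rearrange₂ gl z) (ℤP.+-mono-≤ (ℤP.i≤j⇒0≤j-i z≤0) 0≤gl)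
  where
  rearrange₁ : ∀ gk gl z → (z - (gl - gk)) + gl ≡ gk + z
  rearrange₁ = solve-∀
  rearrange₂ : ∀ gl z → (0ℤ - z) + gl ≡ gl - z
  rearrange₂ = solve-∀

negPart : ℤ → ℕ
negPart (+ _)    = 0
negPart -[1+ n ] = suc n

negPart-nonneg : ∀ {x} → 0ℤ ≤ x → negPart x ≡ 0
negPart-nonneg (+≤+ _) = refl

negPart-antitone : ∀ {x y} → x ≤ y → negPart y ℕ.≤ negPart x
negPart-antitone (-≤- n≤m) = s≤s n≤m
negPart-antitone -≤+       = z≤n
negPart-antitone (+≤+ _)   = z≤n

negPart-conformal : ∀ {d s} → Conformal d s → negPart (d - s) ℕ.≤ negPart d
negPart-conformal (inj₁ (_ , s≤d)) =
  subst (ℕ._≤ _) (sym (negPart-nonneg (ℤP.i≤j⇒0≤j-i s≤d))) z≤n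
negPart-conformal {d} {s} (inj₂ (_ , s≤0)) =
  negPart-antitone (subst (_≤ d - s) (ℤP.+-identityʳ d) (ℤP.+-monoʳ-≤ d (ℤP.neg-mono-≤ s≤0)))

negPart-increment : ∀ {d} → d < 0ℤ → negPart (d - -1ℤ) ℕ.< negPart d
negPart-increment { -[1+ zero ]}  _ = s≤s z≤n
negPart-increment { -[1+ suc n ]} _ = ℕP.≤-refl
negPart-increment {+ _} (+<+ ())

Σℕ-mono-≤ : ∀ n (f g : Fin n → ℕ) → (∀ i → f i ℕ.≤ g i) → Σℕ n f ℕ.≤ Σℕ n g
Σℕ-mono-≤ zero    f g f≤g = z≤n
Σℕ-mono-≤ (suc n) f g f≤g = ℕP.+-mono-≤ (f≤g zero) (Σℕ-mono-≤ n _ _ (λ i → f≤g (suc i)))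

Σℕ-mono-< : ∀ n (f g : Fin n → ℕ) → (∀ i → f i ℕ.≤ g i) → ∀ x → f x ℕ.< g x → Σℕ n f ℕ.< Σℕ n g
Σℕ-mono-< (suc n) f g f≤g zero    fx<gx =
  ℕP.+-mono-<-≤ fx<gx (Σℕ-mono-≤ n _ _ (λ i → f≤g (suc i)))
Σℕ-mono-< (suc n) f g f≤g (suc x) fx<gx =
  ℕP.+-mono-≤-< (f≤g zero) (Σℕ-mono-< n _ _ (λ i → f≤g (suc i)) x fx<gx)

negMass : ∀ {I J} → Mat I J → ℕ
negMass {I} {J} D = Σℕ I (λ i → Σℕ J (λ j → negPart (D i j)))

negMass-< : ∀ {I J} (D E : Mat I J) → (∀ i j → negPart (E i j) ℕ.≤ negPart (D i j)) →
            ∀ a b → negPart (E a b) ℕ.< negPart (D a b) → negMass E ℕ.< negMass D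
negMass-< {I} {J} D E E≤D a b Eab<Dab =
  Σℕ-mono-< I _ _ (λ i → Σℕ-mono-≤ J _ _ (E≤D i)) a (Σℕ-mono-< J _ _ (E≤D a) b Eab<Dab)

-- The square on rows a, a' and columns b, b': +1 at (a,b) and (a',b'), -1 at
-- (a',b) and (a,b').  It is the sum of two column moves, so it can be both
-- subtracted from D and recorded in the cycle being built.
squareMoves : ∀ {I J} → Fin I → Fin I → Fin J → Fin J → List (Move I J)
squareMoves a a' b b' = (a' , a , b) ∷ (a , a' , b') ∷ []

square : ∀ {I J} → Fin I → Fin I → Fin J → Fin J → Mat I J
square a a' b b' = sumMoves (squareMoves a a' b b')

module _ {I J} {a a' : Fin I} {b b' : Fin J} (a≢a' : ¬ a ≡ a') (b≢b' : ¬ b ≡ b') where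

  square-ab : square a a' b b' a b ≡ 1ℤ
  square-ab rewrite dec-true (a ≟ a) refl | dec-false (a ≟ a') a≢a'
                  | dec-true (b ≟ b) refl | dec-false (b ≟ b') b≢b' = refl

  square-a'b : square a a' b b' a' b ≡ -1ℤ
  square-a'b rewrite dec-false (a' ≟ a) (λ e → a≢a' (sym e)) | dec-true (a' ≟ a') refl
                   | dec-true (b ≟ b) refl | dec-false (b ≟ b') b≢b' = refl

  square-ab' : square a a' b b' a b' ≡ -1ℤ
  square-ab' rewrite dec-true (a ≟ a) refl | dec-false (a ≟ a') a≢a'
                   | dec-false (b' ≟ b) (λ e → b≢b' (sym e)) | dec-true (b' ≟ b') refl = refl

  square-other-row : ∀ {i} j → ¬ i ≡ a → ¬ i ≡ a' → square a a' b b' i j ≡ 0ℤ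
  square-other-row {i} j i≢a i≢a' rewrite dec-false (i ≟ a) i≢a | dec-false (i ≟ a') i≢a' = refl

  -- Each row of the square contains one +1 and one -1.
  square-rows : ZeroRowSums (square a a' b b')
  square-rows i =
    trans (Σℤ-add J (moveMat (a' , a , b) i) (λ j → moveMat (a , a' , b') i j + 0ℤ))
          (trans (cong₂ _+_ (move-row a' a b i)
                            (trans (Σℤ-add J (moveMat (a , a' , b') i) (λ _ → 0ℤ))
                                   (cong₂ _+_ (move-row a a' b' i) (Σℤ-zero J))))
                 (cancel (ind (δ i a)) (ind (δ i a'))))
    where
    cancel : ∀ x y → (x - y) + ((y - x) + 0ℤ) ≡ 0ℤ
    cancel = solve-∀

  data SquareEntry : Fin I → Fin J → ℤ → Set where
    at-ab   : SquareEntry a  b   1ℤ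
    at-a'b' : SquareEntry a' b'  1ℤ
    at-a'b  : SquareEntry a' b  -1ℤ
    at-ab'  : SquareEntry a  b' -1ℤ
    off     : ∀ {i j} → SquareEntry i j 0ℤ

  squareEntry : ∀ i j → SquareEntry i j (square a a' b b' i j)
  squareEntry i j with i ≟ a | i ≟ a' | j ≟ b | j ≟ b'
  ... | yes refl | yes i≡a' | _        | _        = ⊥-elim (a≢a' i≡a')
  ... | _        | _        | yes refl | yes j≡b' = ⊥-elim (b≢b' j≡b')
  ... | yes refl | no _     | yes refl | no _     = at-ab
  ... | yes refl | no _     | no _     | yes refl = at-ab'
  ... | yes refl | no _     | no _     | no _     = off
  ... | no _     | yes refl | yes refl | no _     = at-a'b
  ... | no _     | yes refl | no _     | yes refl = at-a'b'
  ... | no _     | yes refl | no _     | no _     = off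
  ... | no _     | no _     | _        | _        = off

  square-conformal : (D : Mat I J) → 0ℤ < D a b → D a b' < 0ℤ → 0ℤ < D a' b' →
                     ∀ i j → ¬ (i ≡ a' × j ≡ b) → Conformal (D i j) (square a a' b b' i j)
  square-conformal D 0<Dab Dab'<0 0<Da'b' i j not-a'b
    with square a a' b b' i j | squareEntry i j
  ... | _ | at-ab   = conformal-one 0<Dab
  ... | _ | at-a'b' = conformal-one 0<Da'b'
  ... | _ | at-a'b  = ⊥-elim (not-a'b (refl , refl))
  ... | _ | at-ab'  = conformal-minus-one Dab'<0
  ... | _ | off     = conformal-zero (D i j)

  -- When (a',b) is not negative, subtracting the square lowers the negative mass:
  -- it removes a conformal part elsewhere and strictly raises D a b' < 0.
  square-reduces-mass : (D : Mat I J) → 0ℤ < D a b → D a b' < 0ℤ → 0ℤ < D a' b' → 0ℤ ≤ D a' b →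
                        negMass (D ⊖ square a a' b b') ℕ.< negMass D
  square-reduces-mass D 0<Dab Dab'<0 0<Da'b' 0≤Da'b =
    negMass-< D (D ⊖ square a a' b b') pointwise a b' strict
    where
    pointwise : ∀ i j → negPart (D i j - square a a' b b' i j) ℕ.≤ negPart (D i j)
    pointwise i j with (i ≟ a') ×-dec (j ≟ b)
    ... | yes (refl , refl) =
      subst (ℕ._≤ _) (sym (negPart-nonneg (subst (λ s → 0ℤ ≤ D a' b - s) (sym square-a'b)
                                                   (ℤP.<⇒≤ (0<+1 0≤Da'b))))) z≤n
    ... | no not-a'b = negPart-conformal (square-conformal D 0<Dab Dab'<0 0<Da'b' i j not-a'b)
    strict : negPart (D a b' - square a a' b b' a b') ℕ.< negPart (D a b')
    strict = subst (λ s → negPart (D a b' - s) ℕ.< _) (sym square-ab') (negPart-increment Dab'<0)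

-- The column condition is what lets a cycle through
-- (a',b) be extended by a square without disturbing (a,b).
record ConformalCycle {I J} (D : Mat I J) (a : Fin I) (b : Fin J) (Z : Mat I J) : Set where
  field
    conformal : ∀ i j → Conformal (D i j) (Z i j)
    unit      : Z a b ≡ 1ℤ
    column    : ∀ i → ¬ i ≡ a → Z i b ≤ 0ℤ
    rows      : ZeroRowSums Z

cycle-cong : ∀ {I J} {D : Mat I J} {a b} {Z W : Mat I J} →
             (∀ i j → Z i j ≡ W i j) → ConformalCycle D a b Z → ConformalCycle D a b W
cycle-cong {J = J} {D} {a} {b} Z≗W cyc = record
  { conformal = λ i j → subst (Conformal (D i j)) (Z≗W i j) (conformal i j)
  ; unit      = trans (sym (Z≗W a b)) unit
  ; column    = λ i i≢a → subst (_≤ 0ℤ) (Z≗W i b) (column i i≢a)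
  ; rows      = λ i → trans (sym (Σℤ-cong J (Z≗W i))) (rows i)
  }
  where open ConformalCycle cyc

module _ {I J} (D : Mat I J) {a a' : Fin I} {b b' : Fin J} (a≢a' : ¬ a ≡ a') (b≢b' : ¬ b ≡ b')
         (0<Dab : 0ℤ < D a b) (Dab'<0 : D a b' < 0ℤ) (0<Da'b' : 0ℤ < D a' b') where

  private
    σ : Mat I J
    σ = square a a' b b'

  square-cycle : D a' b < 0ℤ → ConformalCycle D a b σ
  square-cycle Da'b<0 = record
    { conformal = conformal ; unit = square-ab a≢a' b≢b' ; column = column ; rows = square-rows a≢a' b≢b' }
    where
    conformal : ∀ i j → Conformal (D i j) (σ i j)
    conformal i j with (i ≟ a') ×-dec (j ≟ b)
    ... | yes (refl , refl) = subst (Conformal (D a' b)) (sym (square-a'b a≢a' b≢b')) (conformal-minus-one Da'b<0)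
    ... | no not-a'b        = square-conformal a≢a' b≢b' D 0<Dab Dab'<0 0<Da'b' i j not-a'b
    column-by : ∀ i → ¬ i ≡ a → Dec (i ≡ a') → σ i b ≤ 0ℤ
    column-by _ _   (yes refl) = subst (_≤ 0ℤ) (sym (square-a'b a≢a' b≢b')) -≤+
    column-by i i≢a (no i≢a')  = subst (_≤ 0ℤ) (sym (square-other-row a≢a' b≢b' b i≢a i≢a')) ℤP.≤-refl
    column : ∀ i → ¬ i ≡ a → σ i b ≤ 0ℤ
    column i i≢a = column-by i i≢a (i ≟ a')

  -- Otherwise a conformal cycle of D - σ through (a',b), preceded by σ, is a
  -- conformal cycle of D through (a,b): at (a',b) the square's -1 cancels the
  -- cycle's +1, everywhere else the two conformal pieces compose.
  extend-cycle : ∀ {Z} → 0ℤ ≤ D a' b → ConformalCycle (D ⊖ σ) a' b Z → ConformalCycle D a b (σ ⊕ Z)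
  extend-cycle {Z} 0≤Da'b cyc = record { conformal = conformal ; unit = unit ; column = column ; rows = rows }
    where
    module C = ConformalCycle cyc
    -- Z vanishes at (a,b): it is ≤ 0 there (column b, row a ≠ a') and
    -- conformal to D a b - 1 ≥ 0.
    Zab≡0 : Z a b ≡ 0ℤ
    Zab≡0 = ℤP.≤-antisym (C.column a a≢a')
      (proj₁ (conformal-nonneg (subst (λ s → 0ℤ ≤ D a b - s) (sym (square-ab a≢a' b≢b'))
                                       (ℤP.i≤j⇒0≤j-i (ℤP.i<j⇒suc[i]≤j 0<Dab)))
                               (C.conformal a b)))
    conformal : ∀ i j → Conformal (D i j) (σ i j + Z i j)
    conformal i j with (i ≟ a') ×-dec (j ≟ b)
    ... | yes (refl , refl) =
      subst (Conformal (D a' b)) (sym (cong₂ _+_ (square-a'b a≢a' b≢b') C.unit)) (conformal-zero _)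
    ... | no not-a'b =
      conformal-+ (square-conformal a≢a' b≢b' D 0<Dab Dab'<0 0<Da'b' i j not-a'b) (C.conformal i j)
    unit : σ a b + Z a b ≡ 1ℤ
    unit = cong₂ _+_ (square-ab a≢a' b≢b') Zab≡0
    column-by : ∀ i → ¬ i ≡ a → Dec (i ≡ a') → σ i b + Z i b ≤ 0ℤ
    column-by _ _   (yes refl) = ℤP.≤-reflexive (cong₂ _+_ (square-a'b a≢a' b≢b') C.unit)
    column-by i i≢a (no i≢a')  =
      subst (_≤ 0ℤ) (sym (trans (cong (_+ Z i b) (square-other-row a≢a' b≢b' b i≢a i≢a')) (ℤP.+-identityˡ (Z i b))))
            (C.column i i≢a')
    column : ∀ i → ¬ i ≡ a → σ i b + Z i b ≤ 0ℤ
    column i i≢a = column-by i i≢a (i ≟ a')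
    rows : ZeroRowSums (σ ⊕ Z)
    rows i = trans (Σℤ-add J (σ i) (Z i)) (cong₂ _+_ (square-rows a≢a' b≢b' i) (C.rows i))

-- Recursion on the negative mass, which each extension step decreases.
conformal-cycle : ∀ {I J} (D : Mat I J) → Acc ℕ._<_ (negMass D) → ZeroRowSums D → ZeroColSums D →
                  ∀ a b → 0ℤ < D a b → ∃[ ms ] ConformalCycle D a b (sumMoves ms)
conformal-cycle {I} {J} D (acc smaller) rowsD colsD a b 0<Dab
  with negative-entry J (D a) (rowsD a) b 0<Dab
... | b' , Dab'<0 with positive-entry I (λ i → D i b') (ℤP.≤-reflexive (sym (colsD b'))) a Dab'<0
... | a' , 0<Da'b' = closeOrExtend (D a' b ℤP.<? 0ℤ)
  where
  a≢a' : ¬ a ≡ a'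
  a≢a' = sign-separates (λ i → D i b') Dab'<0 0<Da'b'
  b≢b' : ¬ b ≡ b'
  b≢b' b≡b' = sign-separates (D a) Dab'<0 0<Dab (sym b≡b')
  σ : Mat I J
  σ = square a a' b b'
  closeOrExtend : Dec (D a' b < 0ℤ) → ∃[ ms ] ConformalCycle D a b (sumMoves ms)
  closeOrExtend (yes Da'b<0) =
    squareMoves a a' b b' , square-cycle D a≢a' b≢b' 0<Dab Dab'<0 0<Da'b' Da'b<0
  closeOrExtend (no Da'b≮0) =
    continue (conformal-cycle (D ⊖ σ) (smaller lower) rows-reduced cols-reduced a' b 0<Da'b+1)
    where
    0≤Da'b : 0ℤ ≤ D a' b
    0≤Da'b = ℤP.≮⇒≥ Da'b≮0
    lower : negMass (D ⊖ σ) ℕ.< negMass D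
    lower = square-reduces-mass a≢a' b≢b' D 0<Dab Dab'<0 0<Da'b' 0≤Da'b
    rows-reduced : ZeroRowSums (D ⊖ σ)
    rows-reduced i = trans (Σℤ-sub J (D i) (σ i)) (cong₂ _-_ (rowsD i) (square-rows a≢a' b≢b' i))
    cols-reduced : ZeroColSums (D ⊖ σ)
    cols-reduced j = trans (Σℤ-sub I (λ i → D i j) (λ i → σ i j))
                           (cong₂ _-_ (colsD j) (moves-columns (squareMoves a a' b b') j))
    0<Da'b+1 : 0ℤ < D a' b - σ a' b
    0<Da'b+1 = subst (λ s → 0ℤ < D a' b - s) (sym (square-a'b a≢a' b≢b')) (0<+1 0≤Da'b)
    continue : ∃[ ms ] ConformalCycle (D ⊖ σ) a' b (sumMoves ms) →
               ∃[ ms ] ConformalCycle D a b (sumMoves ms)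
    continue (ms , cyc) =
      squareMoves a a' b b' ++ ms ,
      cycle-cong (λ i j → sym (sumMoves-++ (squareMoves a a' b b') ms i j))
                 (extend-cycle D a≢a' b≢b' 0<Dab Dab'<0 0<Da'b' 0≤Da'b cyc)

-- Exchange along a conformal cycle Z of B - A through the improper entry of A:
-- away from (i*,j*), A + Z and B - Z lie between A and B, and at (i*,j*) the
-- unit of Z cancels the -1 of A; the margins are kept since Z has zero margins.
exchange : ∀ {I J} {r : Fin I → ℕ} {c : Fin J → ℕ} {A B : Mat I J} {i* j*} (ms : List (Move I J)) →
           HasMargins r c A → A i* j* ≡ -[1+ 0 ] → (∀ i j → ¬ (i ≡ i* × j ≡ j*) → 0ℤ ≤ A i j) →
           Proper r c B → 0ℤ < B i* j* → ConformalCycle (B ⊖ A) i* j* (sumMoves ms) →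
           Proper r c (A ⊕ sumMoves ms) × Proper r c (B ⊖ sumMoves ms)
exchange {A = A} {B} {i*} {j*} ms marginsA A*≡-1 0≤A (marginsB , 0≤B) 0<B* cyc =
  (margins-⊕ marginsA rows (moves-columns ms) , λ i j → proj₁ (nonneg i j ((i ≟ i*) ×-dec (j ≟ j*)))) ,
  (margins-⊖ marginsB rows (moves-columns ms) , λ i j → proj₂ (nonneg i j ((i ≟ i*) ×-dec (j ≟ j*))))
  where
  open ConformalCycle cyc
  Z : Mat _ _
  Z = sumMoves ms
  nonneg : ∀ i j → Dec (i ≡ i* × j ≡ j*) → 0ℤ ≤ A i j + Z i j × 0ℤ ≤ B i j - Z i j
  nonneg _ _ (yes (refl , refl)) =
    subst (0ℤ ≤_) (sym (cong₂ _+_ A*≡-1 unit)) ℤP.≤-refl ,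
    subst (λ z → 0ℤ ≤ B i* j* - z) (sym unit) (ℤP.i≤j⇒0≤j-i (ℤP.i<j⇒suc[i]≤j 0<B*))
  nonneg i j (no away) = conformal-interpolate (conformal i j) (0≤A i j away) (0≤B i j)

repair : ∀ {I J} {r : Fin I → ℕ} {c : Fin J → ℕ} {A B : Mat I J} {i* j*} →
         HasMargins r c A → A i* j* ≡ -[1+ 0 ] → (∀ i j → ¬ (i ≡ i* × j ≡ j*) → 0ℤ ≤ A i j) →
         Proper r c B → 0ℤ < B i* j* →
         ∃[ ms ] (Proper r c (A ⊕ sumMoves ms) × Proper r c (B ⊖ sumMoves ms))
repair {r = r} {c} {A} {B} {i*} {j*} marginsA A*≡-1 0≤A properB 0<B* =
  finish (conformal-cycle (B ⊖ A) (<-wellFounded _) (proj₁ balanced) (proj₂ balanced) i* j* 0<D*)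
  where
  balanced : ZeroRowSums (B ⊖ A) × ZeroColSums (B ⊖ A)
  balanced = margins-difference (proj₁ properB) marginsA
  0<D* : 0ℤ < B i* j* - A i* j*
  0<D* = subst (λ a → 0ℤ < B i* j* - a) (sym A*≡-1) (0<+1 (ℤP.<⇒≤ 0<B*))
  finish : ∃[ ms ] ConformalCycle (B ⊖ A) i* j* (sumMoves ms) →
           ∃[ ms ] (Proper r c (A ⊕ sumMoves ms) × Proper r c (B ⊖ sumMoves ms))
  finish (ms , cyc) = ms , exchange ms marginsA A*≡-1 0≤A properB 0<B* cyc

swap-proper : ∀ {I J N} {r : Fin I → ℕ} {c : Fin J → ℕ} (G : Fin N → Mat I J) {k₁ k₂} (Z : Mat I J) →
              Proper r c (G k₁ ⊕ Z) → Proper r c (G k₂ ⊖ Z) →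
              (∀ l → ¬ l ≡ k₁ → ¬ l ≡ k₂ → Proper r c (G l)) →
              ProperFamily r c (swap G k₁ k₂ Z)
swap-proper G {k₁} {k₂} Z proper₁ proper₂ untouched l with l ≟ k₁ | l ≟ k₂
... | yes refl | _        = proper₁
... | no l≢k₁  | yes refl = proper₂
... | no l≢k₁  | no l≢k₂  = untouched l l≢k₁ l≢k₂

-- The column sum at the improper entry is nonnegative, so some other graph
-- g_l is positive there; repairing g_k with g_l is the required swap.
lemma4p6 : {I J N : ℕ} (r : Fin I → ℕ) (c : Fin J → ℕ) →
           Σℕ I r ≡ Σℕ J c →
           (G : Fin N → Mat I J) (k : Fin N) →
           ImproperFamilyAt r c G k →
           ∃[ k₁ ] ∃[ k₂ ] ∃[ ms ]
             (¬ (k₁ ≡ k₂) × ProperFamily r c (swap G k₁ k₂ (sumMoves ms)))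
lemma4p6 {N = N} r c _ G k ((marginsk , i* , j* , Gk*≡-1 , 0≤Gk) , others , 0≤columnSums) =
  swapWith (positive-entry N (λ l → G l i* j*) (0≤columnSums i* j*) k Gk*<0)
  where
  Gk*<0 : G k i* j* < 0ℤ
  Gk*<0 = subst (_< 0ℤ) (sym Gk*≡-1) -<+
  swapWith : ∃[ l ] 0ℤ < G l i* j* →
             ∃[ k₁ ] ∃[ k₂ ] ∃[ ms ] (¬ (k₁ ≡ k₂) × ProperFamily r c (swap G k₁ k₂ (sumMoves ms)))
  swapWith (l , 0<Gl*) =
    let k≢l = sign-separates (λ l → G l i* j*) Gk*<0 0<Gl*
        (ms , properk , properl) = repair marginsk Gk*≡-1 0≤Gk (others l (λ l≡k → k≢l (sym l≡k))) 0<Gl*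
    in k , l , ms , k≢l , swap-proper G (sumMoves ms) properk properl (λ l' l'≢k _ → others l' l'≢k)
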